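{- Let $\mathcal N$ be a Petri net with deficiency zero. Then $\mathcal N$ is weakly reversible if and only if there exists a marking $m_0$ such that $(\mathcal N,m_0)$ is live and $m_0$ is a home marking of $(\mathcal N,m_0)$.
   Context: A Petri net is $\mathcal N=(P,T,W^-,W^+)$ with finite disjoint sets $P,T$ and $W^-,W^+\in\mathbb N^{P\times T}$; $W=W^+-W^-$. ${}^\bullet t$ (resp. $t^\bullet$) is the column of $W^-$ (resp. $W^+$) indexed by $t$. A marking is $m\in\mathbb N^P$; $t$ is enabled at $m$ if $m\ge {}^\bullet t$, and firing yields $m-{}^\bullet t+t^\bullet$. $\mathcal R(m)$ is the set of markings reachable from $m$. $(\mathcal N,m_0)$ is live if for every $m\in\mathcal R(m_0)$ and $t\in T$ some $m'\in\mathcal R(m)$ enables $t$. A home marking of $(\mathcal N,m_0)$ is a marking reachable from every marking in $\mathcal R(m_0)$. Complexes: $\mathcal C=\{{}^\bullet t\}\cup\{t^\bullet\}$; reaction graph: nodes $\mathcal C$, arcs $({}^\bullet t,t^\bullet)$. Weakly reversible: every connected component of the reaction graph is strongly connected. Deficiency: $|\mathcal C|-\ell-\mathrm{rank}(W)$, $\ell$ the number of connected components of the reaction graph. -}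

module Defs where

import Data.Nat as ℕ
open import Data.Nat using (ℕ; _≤_; _+_; _∸_)
open import Data.Integer as ℤ using (ℤ; +_; 0ℤ)
open import Data.Fin using (Fin; zero; suc)
import Data.Vec
open import Data.Vec using (Vec; zipWith; replicate)
open import Data.Vec.Relation.Binary.Pointwise.Inductive using (Pointwise)
open import Data.Product using (Σ; ∃; ∃-syntax; _×_; _,_)
open import Data.Sum using (_⊎_)
open import Relation.Nullary using (¬_)
open import Relation.Binary.PropositionalEquality using (_≡_)
open import Relation.Binary.Construct.Closure.ReflexiveTransitive using (Star)
open import Relation.Binary.Construct.Closure.Symmetric using (SymClosure)
open import Function.Definitions using (Injective)

-- A Petri net with places P = Fin p and transitions T = Fin n.
-- pre t  = column of W⁻ indexed by t  (= •t),
-- post t = column of W⁺ indexed by t  (= t•).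
record PetriNet (p n : ℕ) : Set where
  field
    pre  : Fin n → Vec ℕ p
    post : Fin n → Vec ℕ p
open PetriNet public

Marking : ℕ → Set
Marking p = Vec ℕ p

module _ {p n : ℕ} (N : PetriNet p n) where

  Enabled : Fin n → Marking p → Set
  Enabled t m = Pointwise _≤_ (pre N t) m

  fire : Marking p → Fin n → Marking p
  fire m t = zipWith _+_ (zipWith _∸_ m (pre N t)) (post N t)

  Step : Marking p → Marking p → Set
  Step m m' = ∃[ t ] (Enabled t m × m' ≡ fire m t)

  Reach : Marking p → Marking p → Set
  Reach = Star Step

  Live : Marking p → Set
  Live m₀ = ∀ m → Reach m₀ m → ∀ t → ∃[ m' ] (Reach m m' × Enabled t m')

  HomeMarking : Marking p → Marking p → Set
  HomeMarking m₀ h = ∀ m → Reach m₀ m → Reach m h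

  IsComplex : Vec ℕ p → Set
  IsComplex c = ∃[ t ] (c ≡ pre N t ⊎ c ≡ post N t)

  Arc : Vec ℕ p → Vec ℕ p → Set
  Arc c d = ∃[ t ] (c ≡ pre N t × d ≡ post N t)

  Connected : Vec ℕ p → Vec ℕ p → Set
  Connected = Star (SymClosure Arc)

  WeaklyReversible : Set
  WeaklyReversible = ∀ c d → IsComplex c → IsComplex d →
                     Connected c d → Star Arc c d

  -- |𝒞| = k : an enumeration of the complexes without repetition
  NumComplexes : ℕ → Set
  NumComplexes k = Σ (Fin k → Vec ℕ p) λ f →
    Injective _≡_ _≡_ f × (∀ i → IsComplex (f i)) ×
    (∀ c → IsComplex c → ∃[ i ] (f i ≡ c))

  -- ℓ = k : k complexes, one in each connected component
  NumComponents : ℕ → Set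
  NumComponents k = Σ (Fin k → Vec ℕ p) λ r →
    (∀ i → IsComplex (r i)) ×
    (∀ i j → Connected (r i) (r j) → i ≡ j) ×
    (∀ c → IsComplex c → ∃[ i ] Connected c (r i))

  Wcol : Fin n → Vec ℤ p
  Wcol t = zipWith (λ a b → + a ℤ.- + b) (post N t) (pre N t)

linComb : {p : ℕ} (k : ℕ) → (Fin k → ℤ) → (Fin k → Vec ℤ p) → Vec ℤ p
linComb {p} ℕ.zero    c v = replicate p 0ℤ
linComb {p} (ℕ.suc k) c v =
  zipWith ℤ._+_ (Data.Vec.map (c zero ℤ.*_) (v zero))
                (linComb k (λ i → c (suc i)) (λ i → v (suc i)))

-- linear independence (over ℤ, equivalently over ℚ) of a family of k vectors
LinIndep : {p : ℕ} (k : ℕ) → (Fin k → Vec ℤ p) → Set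
LinIndep {p} k v = ∀ (c : Fin k → ℤ) → linComb k c v ≡ replicate p 0ℤ → ∀ i → c i ≡ 0ℤ

module _ {p n : ℕ} (N : PetriNet p n) where

  RankW : ℕ → Set
  RankW r = (Σ (Fin r → Fin n) λ σ → LinIndep r (λ i → Wcol N (σ i))) ×
            (∀ (σ : Fin (ℕ.suc r) → Fin n) → ¬ LinIndep (ℕ.suc r) (λ i → Wcol N (σ i)))

  -- deficiency δ = |𝒞| − ℓ − rank(W), i.e. |𝒞| = δ + ℓ + rank(W)
  Deficiency : ℕ → Set
  Deficiency δ = ∃[ c ] ∃[ l ] ∃[ r ]
    (NumComplexes N c × NumComponents N l × RankW r × c ≡ δ + l + r)

-- (⇒) When every arc •t → t• of the reaction graph lies on a cycle, a firing of t can be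
-- undone by firing the transitions along the path t• →* •t, so reachability is symmetric
-- and the sum of all pre-sets is a live home marking.
-- (⇐) Cycles through a live home marking m₀ firing each transition add up (marking
-- equation) to a positive T-invariant X. Let Y be the complex × transition incidence
-- matrix of the reaction graph, so that W = F Y where F has the complexes as columns.
-- If z = Y X were nonzero, then z, one unit vector per connected component and r columns
-- of Y with independent W-images would be |𝒞| + 1 independent vectors of ℤ^𝒞 (test
-- against component indicators, then against the rows of F), contradicting deficiency
-- zero, |𝒞| = ℓ + rank W. A positive flow X with Y X = 0 puts every arc on a cycle,
-- which is weak reversibility.

module Submission where

open import Defs

open import Data.Nat as ℕ using (ℕ; zero; suc; z≤n; s≤s)
import Data.Nat.Properties as ℕP
open import Data.Integer as ℤ using (ℤ; +_; 0ℤ; 1ℤ; _+_; _*_; -_; _-_; _≤_; _<_)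
import Data.Integer.Properties as ℤP
open import Algebra.Properties.AbelianGroup ℤP.+-0-abelianGroup using (identityʳ-unique)
open import Data.Integer.Tactic.RingSolver using (solve-∀)
open import Data.Fin as Fin using (Fin; zero; suc; toℕ; punchIn; _↑ˡ_; _↑ʳ_)
import Data.Fin.Properties as FinP
open import Data.Vec.Functional using (Vector; insertAt; _∷_; _++_)
open import Data.Vec.Functional.Properties using (insertAt-lookup; insertAt-punchIn; lookup-++ˡ; lookup-++ʳ)
open import Data.Product using (Σ; ∃; ∃-syntax; _×_; _,_; proj₁; proj₂)
open import Data.Sum using (_⊎_; inj₁; inj₂; [_,_])
open import Function using (_∘_)
open import Function.Bundles using (_⇔_; mk⇔)
open import Relation.Binary.PropositionalEquality
  using (_≡_; _≢_; refl; sym; trans; cong; cong₂; subst; subst₂; module ≡-Reasoning)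
import Data.Vec as Vec
open import Data.Vec using (Vec; lookup; zipWith; tabulate)
open import Data.Vec.Properties using (lookup-zipWith; lookup-map; lookup-replicate; lookup∘tabulate)
import Data.Vec.Relation.Binary.Pointwise.Inductive as Pointwise
open import Relation.Nullary using (¬_; Dec; yes; no; ¬?; contradiction)
open import Relation.Nullary.Decidable using (decidable-stable; map′; _⊎-dec_; _×-dec_)
open import Relation.Binary.Construct.Closure.ReflexiveTransitive using (Star; ε; _◅_; _◅◅_; gmap; concat; reverse; _⋆)
open import Relation.Binary.Construct.Closure.Symmetric as SymClosure using (SymClosure; fwd; bwd)
open import Data.Vec.Relation.Binary.Pointwise.Extensional as PointwiseExt using (ext)
import Algebra.Properties.Semiring.Sum
open import Algebra.Properties.Semiring.Sum ℤP.+-*-semiring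
  using (sum; sum-cong-≗; sum-replicate-zero; sum-remove; ∑-distrib-+; ∑-comm; *-distribˡ-sum; *-distribʳ-sum)

module ℕΣ = Algebra.Properties.Semiring.Sum ℕP.+-*-semiring

private variable k m p n : ℕ

-- Finite sums and dot products over ℤ

sum-zero : {f : Vector ℤ k} → (∀ i → f i ≡ 0ℤ) → sum f ≡ 0ℤ
sum-zero {k} f≗0 = trans (sum-cong-≗ f≗0) (sum-replicate-zero k)

sum-neg : (f : Vector ℤ k) → sum (λ i → - f i) ≡ - sum f
sum-neg {zero}  f = refl
sum-neg {suc k} f = trans (cong (_+_ (- f zero)) (sum-neg (f ∘ suc))) (sym (ℤP.neg-distrib-+ (f zero) _))

sum-distrib-- : (f g : Vector ℤ k) → sum (λ i → f i - g i) ≡ sum f - sum g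
sum-distrib-- f g = trans (∑-distrib-+ f (λ i → - g i)) (cong (_+_ (sum f)) (sum-neg g))

sum-↑ : ∀ l r (f : Vector ℤ (l ℕ.+ r)) → sum f ≡ sum (f ∘ (_↑ˡ r)) + sum (f ∘ (l ↑ʳ_))
sum-↑ zero    r f = sym (ℤP.+-identityˡ _)
sum-↑ (suc l) r f = trans (cong (_+_ (f zero)) (sum-↑ l r (f ∘ suc))) (sym (ℤP.+-assoc (f zero) _ _))

sum-nonneg : (f : Vector ℤ k) → (∀ i → 0ℤ ≤ f i) → 0ℤ ≤ sum f
sum-nonneg {zero}  f f≥0 = ℤP.≤-refl
sum-nonneg {suc k} f f≥0 = ℤP.+-mono-≤ (f≥0 zero) (sum-nonneg (f ∘ suc) (f≥0 ∘ suc))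

≤-sum : (f : Vector ℤ k) → (∀ i → 0ℤ ≤ f i) → ∀ i → f i ≤ sum f
≤-sum {suc k} f f≥0 i = begin
  f i                                ≡⟨ ℤP.+-identityʳ (f i) ⟨
  f i + 0ℤ                           ≤⟨ ℤP.+-monoʳ-≤ (f i) (sum-nonneg (f ∘ punchIn i) (f≥0 ∘ punchIn i)) ⟩
  f i + sum (f ∘ punchIn i)          ≡⟨ sum-remove f ⟨
  sum f                              ∎
  where open ℤP.≤-Reasoning

≤-sumℕ : (f : Fin k → ℕ) (i : Fin k) → f i ℕ.≤ ℕΣ.sum f
≤-sumℕ {suc k} f i = subst (f i ℕ.≤_) (sym (ℕΣ.sum-remove {i = i} f)) (ℕP.m≤m+n (f i) _)

𝟙 : {P : Set} → Dec P → ℤ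
𝟙 (yes _) = 1ℤ
𝟙 (no _)  = 0ℤ

𝟙-yes : {P : Set} → P → (d : Dec P) → 𝟙 d ≡ 1ℤ
𝟙-yes p (yes _) = refl
𝟙-yes p (no ¬p) = contradiction p ¬p

𝟙-no : {P : Set} → ¬ P → (d : Dec P) → 𝟙 d ≡ 0ℤ
𝟙-no ¬p (yes p) = contradiction p ¬p
𝟙-no ¬p (no _)  = refl

𝟙-nonneg : {P : Set} (d : Dec P) → 0ℤ ≤ 𝟙 d
𝟙-nonneg (yes _) = ℤ.+≤+ z≤n
𝟙-nonneg (no _)  = ℤP.≤-refl

𝟙-mono : {P Q : Set} → (P → Q) → (d : Dec P) (e : Dec Q) → 𝟙 d ≤ 𝟙 e
𝟙-mono P⇒Q (yes p) e       = ℤP.≤-reflexive (sym (𝟙-yes (P⇒Q p) e))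
𝟙-mono P⇒Q (no _)  (yes _) = ℤ.+≤+ z≤n
𝟙-mono P⇒Q (no _)  (no _)  = ℤP.≤-refl

𝟙-cong : {P Q : Set} → (P → Q) → (Q → P) → (d : Dec P) (e : Dec Q) → 𝟙 d ≡ 𝟙 e
𝟙-cong P⇒Q Q⇒P d e = ℤP.≤-antisym (𝟙-mono P⇒Q d e) (𝟙-mono Q⇒P e d)

infix 7 _·_

_·_ : Vector ℤ k → Vector ℤ k → ℤ
u · v = sum (λ i → u i * v i)

·-comm : (u v : Vector ℤ k) → u · v ≡ v · u
·-comm u v = sum-cong-≗ (λ i → ℤP.*-comm (u i) (v i))

e : Fin k → Vector ℤ k
e i j = 𝟙 (i Fin.≟ j)

·-e : (u : Vector ℤ k) (i : Fin k) → u · e i ≡ u i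
·-e {suc k} u i = begin
  u · e i                                              ≡⟨ sum-remove (λ j → u j * e i j) ⟩
  u i * e i i + sum (λ j → u (punchIn i j) * e i (punchIn i j))
                                                       ≡⟨ cong₂ _+_ (cong (u i *_) (𝟙-yes refl (i Fin.≟ i))) (sum-zero off-diagonal) ⟩
  u i * 1ℤ + 0ℤ                                        ≡⟨ trans (ℤP.+-identityʳ _) (ℤP.*-identityʳ (u i)) ⟩
  u i                                                  ∎
  where
  open ≡-Reasoning
  off-diagonal : ∀ j → u (punchIn i j) * e i (punchIn i j) ≡ 0ℤ
  off-diagonal j = trans (cong (u (punchIn i j) *_) (𝟙-no (FinP.punchInᵢ≢i i j ∘ sym) (i Fin.≟ punchIn i j)))
                         (ℤP.*-zeroʳ (u (punchIn i j)))

combination : (Fin m → ℤ) → (Fin m → Vector ℤ k) → Vector ℤ k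
combination c v j = c · (λ i → v i j)

·-combination : (u : Vector ℤ k) (c : Fin m → ℤ) (v : Fin m → Vector ℤ k) →
                u · combination c v ≡ c · (λ i → u · v i)
·-combination u c v = begin
  sum (λ j → u j * sum (λ i → c i * v i j))       ≡⟨ sum-cong-≗ (λ j → *-distribˡ-sum (u j) (λ i → c i * v i j)) ⟩
  sum (λ j → sum (λ i → u j * (c i * v i j)))     ≡⟨ ∑-comm (λ j i → u j * (c i * v i j)) ⟩
  sum (λ i → sum (λ j → u j * (c i * v i j)))     ≡⟨ sum-cong-≗ (λ i → sum-cong-≗ (λ j → swap (u j) (c i) (v i j))) ⟩
  sum (λ i → sum (λ j → c i * (u j * v i j)))     ≡⟨ sum-cong-≗ (λ i → *-distribˡ-sum (c i) (λ j → u j * v i j)) ⟨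
  sum (λ i → c i * sum (λ j → u j * v i j))       ∎
  where
  open ≡-Reasoning
  swap : ∀ x y z → x * (y * z) ≡ y * (x * z)
  swap = solve-∀

combination-e+ : (t : Fin m) (c : Fin m → ℤ) (v : Fin m → Vector ℤ k) (j : Fin k) →
                 combination (λ s → e t s + c s) v j ≡ v t j + combination c v j
combination-e+ t c v j = begin
  sum (λ s → (e t s + c s) * v s j)                      ≡⟨ sum-cong-≗ (λ s → ℤP.*-distribʳ-+ (v s j) (e t s) (c s)) ⟩
  sum (λ s → e t s * v s j + c s * v s j)                ≡⟨ ∑-distrib-+ (λ s → e t s * v s j) (λ s → c s * v s j) ⟩
  e t · (λ s → v s j) + combination c v j                ≡⟨ cong (_+ combination c v j) (trans (·-comm (e t) (λ s → v s j)) (·-e (λ s → v s j) t)) ⟩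
  v t j + combination c v j                              ∎
  where open ≡-Reasoning

sum-· : (Y : Fin m → Vector ℤ k) (u : Vector ℤ k) → (λ s → sum (λ t → Y t s)) · u ≡ sum (λ t → Y t · u)
sum-· Y u = trans (sum-cong-≗ (λ s → *-distribʳ-sum (u s) (λ t → Y t s))) (∑-comm (λ s t → Y t s * u s))

-- Linear independence

LinearlyIndependent : (Fin m → Vector ℤ k) → Set
LinearlyIndependent {m} v = (c : Fin m → ℤ) → (∀ j → combination c v j ≡ 0ℤ) → ∀ i → c i ≡ 0ℤ

independent-tail : (v : Fin m → Vector ℤ (suc k)) → (∀ i → v i zero ≡ 0ℤ) →
                   LinearlyIndependent v → LinearlyIndependent (λ i → v i ∘ suc)
independent-tail v v₀≡0 ind c c·v≡0 = ind c λ where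
  zero    → sum-zero (λ i → trans (cong (c i *_) (v₀≡0 i)) (ℤP.*-zeroʳ (c i)))
  (suc j) → c·v≡0 j

pivotRows : (v : Fin (suc m) → Vector ℤ (suc k)) → Fin (suc m) → Fin m → Vector ℤ (suc k)
pivotRows v i j col = v i zero * v (punchIn i j) col - v (punchIn i j) zero * v i col

pivotRows-zero : (v : Fin (suc m) → Vector ℤ (suc k)) (i : Fin (suc m)) (j : Fin m) →
                 pivotRows v i j zero ≡ 0ℤ
pivotRows-zero v i j = cancel (v i zero) (v (punchIn i j) zero)
  where
  cancel : ∀ a b → a * b - b * a ≡ 0ℤ
  cancel = solve-∀

combination-pivotRows : (v : Fin (suc m) → Vector ℤ (suc k)) (i : Fin (suc m)) (c' : Fin m → ℤ) →
  let a = v i zero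
      s = c' · (λ j → v (punchIn i j) zero)
  in ∀ col → combination (insertAt (λ j → a * c' j) i (- s)) v col ≡ combination c' (pivotRows v i) col
combination-pivotRows v i c' col = begin
  c · (λ l → v l col)                                        ≡⟨ sum-remove (λ l → c l * v l col) ⟩
  c i * v i col + sum (λ j → c (punchIn i j) * row j col)    ≡⟨ cong₂ _+_ (cong (_* v i col) (insertAt-lookup _ i (- s)))
                                                                  (sum-cong-≗ λ j → cong (_* row j col) (insertAt-punchIn _ i (- s) j)) ⟩
  - s * v i col + sum (λ j → a * c' j * row j col)           ≡⟨ ℤP.+-comm (- s * v i col) _ ⟩
  sum (λ j → a * c' j * row j col) + - s * v i col           ≡⟨ cong (_+_ (sum (λ j → a * c' j * row j col))) pivot-term ⟩
  sum (λ j → a * c' j * row j col) + sum (λ j → - (c' j * row j zero) * v i col)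
                                                             ≡⟨ ∑-distrib-+ (λ j → a * c' j * row j col) _ ⟨
  sum (λ j → a * c' j * row j col + - (c' j * row j zero) * v i col)
                                                             ≡⟨ sum-cong-≗ (λ j → expand (c' j) a (row j col) (row j zero) (v i col)) ⟩
  c' · (λ j → pivotRows v i j col)                           ∎
  where
  open ≡-Reasoning
  a : ℤ
  a = v i zero
  row : Fin _ → Vector ℤ _
  row = v ∘ punchIn i
  s : ℤ
  s = c' · (λ j → row j zero)
  c : Fin _ → ℤ
  c = insertAt (λ j → a * c' j) i (- s)
  pivot-term : - s * v i col ≡ sum (λ j → - (c' j * row j zero) * v i col)
  pivot-term = trans (cong (_* v i col) (sym (sum-neg (λ j → c' j * row j zero))))
                     (*-distribʳ-sum (v i col) (λ j → - (c' j * row j zero)))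
  expand : ∀ x a y b z → a * x * y + - (x * b) * z ≡ x * (a * y - b * z)
  expand = solve-∀

independent-pivotRows : (v : Fin (suc m) → Vector ℤ (suc k)) (i : Fin (suc m)) → v i zero ≢ 0ℤ →
                        LinearlyIndependent v → LinearlyIndependent (pivotRows v i)
independent-pivotRows v i a≢0 ind c' c'·w≡0 j =
  ℤP.*-cancelˡ-≡ (v i zero) (c' j) 0ℤ {{ℤ.≢-nonZero a≢0}} (trans a*c'ⱼ≡0 (sym (ℤP.*-zeroʳ (v i zero))))
  where
  c : Fin _ → ℤ
  c = insertAt (λ j → v i zero * c' j) i (- (c' · (λ j → v (punchIn i j) zero)))
  a*c'ⱼ≡0 : v i zero * c' j ≡ 0ℤ
  a*c'ⱼ≡0 = trans (sym (insertAt-punchIn _ i _ j))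
                  (ind c (λ col → trans (combination-pivotRows v i c' col) (c'·w≡0 col)) (punchIn i j))

independent⇒≤ : (v : Fin m → Vector ℤ k) → LinearlyIndependent v → m ℕ.≤ k
independent⇒≤ {zero}  {k}     v ind = z≤n
independent⇒≤ {suc m} {zero}  v ind = contradiction (ind (λ _ → 1ℤ) (λ ()) zero) λ ()
independent⇒≤ {suc m} {suc k} v ind with FinP.any? (λ i → ¬? (v i zero ℤ.≟ 0ℤ))
... | yes (i , vᵢ₀≢0) =
  s≤s (independent⇒≤ (λ j → pivotRows v i j ∘ suc)
        (independent-tail (pivotRows v i) (pivotRows-zero v i) (independent-pivotRows v i vᵢ₀≢0 ind)))
... | no ∄i = ℕP.m≤n⇒m≤1+n (independent⇒≤ (λ i → v i ∘ suc) (independent-tail v v₀≡0 ind))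
  where
  v₀≡0 : ∀ i → v i zero ≡ 0ℤ
  v₀≡0 i = decidable-stable (v i zero ℤ.≟ 0ℤ) (λ vᵢ₀≢0 → ∄i (i , vᵢ₀≢0))

lookup-ext : {A : Set} {xs ys : Vec A p} → (∀ q → lookup xs q ≡ lookup ys q) → xs ≡ ys
lookup-ext xs≗ys = Pointwise.Pointwise-≡⇒≡ (PointwiseExt.extensional⇒inductive (ext xs≗ys))

lookup-linComb : (k : ℕ) (c : Fin k → ℤ) (v : Fin k → Vec ℤ p) (q : Fin p) →
                 lookup (linComb k c v) q ≡ combination c (λ i → lookup (v i)) q
lookup-linComb zero    c v q = lookup-replicate q 0ℤ
lookup-linComb (suc k) c v q =
  trans (lookup-zipWith _+_ q (Vec.map (c zero *_) (v zero)) (linComb k (c ∘ suc) (v ∘ suc)))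
        (cong₂ _+_ (lookup-map q (c zero *_) (v zero)) (lookup-linComb k (c ∘ suc) (v ∘ suc) q))

linIndep⇒independent : (v : Fin k → Vec ℤ p) → LinIndep k v → LinearlyIndependent (λ i → lookup (v i))
linIndep⇒independent {k} v indep c comb≡0 =
  indep c (lookup-ext λ q → trans (lookup-linComb k c v q) (trans (comb≡0 q) (sym (lookup-replicate q 0ℤ))))

-- Reachability in finite graphs

module _ {k : ℕ} {R : Fin k → Fin k → Set} (R? : ∀ u v → Dec (R u v)) (a : Fin k) where

  Within : ℕ → Fin k → Set
  Within zero    v = a ≡ v
  Within (suc L) v = Within L v ⊎ ∃ λ u → Within L u × R u v

  within? : ∀ L v → Dec (Within L v)
  within? zero    v = a Fin.≟ v
  within? (suc L) v = within? L v ⊎-dec FinP.any? (λ u → within? L u ×-dec R? u v)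

  within⇒star : ∀ {L v} → Within L v → Star R a v
  within⇒star {zero}  refl               = ε
  within⇒star {suc L} (inj₁ w)           = within⇒star w
  within⇒star {suc L} (inj₂ (u , w , r)) = within⇒star w ◅◅ (r ◅ ε)

  within-mono : ∀ {L L' v} → L ℕ.≤′ L' → Within L v → Within L' v
  within-mono ℕ.≤′-refl      w = w
  within-mono (ℕ.≤′-step L≤L') w = inj₁ (within-mono L≤L' w)

  Fresh : ℕ → Fin k → Set
  Fresh L v = Within (suc L) v × ¬ Within L v

  fresh? : ∀ L v → Dec (Fresh L v)
  fresh? L v = within? (suc L) v ×-dec ¬? (within? L v)

  Saturated : ℕ → Set
  Saturated L = ¬ ∃ (Fresh L)

  saturated⇒closed : ∀ {L u v} → Saturated L → Within L u → Star R u v → Within L v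
  saturated⇒closed sat w ε = w
  saturated⇒closed {L} {u} sat w (_◅_ {j = v} r rs) with within? L v
  ... | yes w' = saturated⇒closed sat w' rs
  ... | no ¬w' = contradiction (v , inj₂ (u , w , r) , ¬w') sat

  -- A fresh vertex at every level L ≤ k would give k + 1 distinct vertices.
  saturation : ∃ Saturated
  saturation with FinP.all? (λ (L : Fin (suc k)) → FinP.any? (fresh? (toℕ L)))
  ... | no ¬fresh = let L , ¬∃fresh = FinP.¬∀⟶∃¬ _ _ (λ L → FinP.any? (fresh? (toℕ L))) ¬fresh in toℕ L , ¬∃fresh
  ... | yes fresh with FinP.pigeonhole (ℕP.n<1+n k) (proj₁ ∘ fresh)
  ...   | i , j , i<j , same =
    contradiction (subst (Within (toℕ j)) same (within-mono (ℕP.≤⇒≤′ i<j) (proj₁ (proj₂ (fresh i)))))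
                  (proj₂ (proj₂ (fresh j)))

  star? : ∀ v → Dec (Star R a v)
  star? v = let L , sat = saturation in map′ within⇒star (saturated⇒closed sat (within-mono ℕP.z≤′n refl)) (within? L v)

module _ {k n : ℕ} (src tgt : Fin n → Fin k) where

  Edge : Fin k → Fin k → Set
  Edge u v = ∃ λ t → src t ≡ u × tgt t ≡ v

  edge? : ∀ u v → Dec (Edge u v)
  edge? u v = FinP.any? (λ t → src t Fin.≟ u ×-dec tgt t Fin.≟ v)

  -- ψ, the indicator of the vertices reachable from tgt t₀, cannot decrease along an edge,
  -- so a balanced positive flow forces ψ (src t₀) = 1.
  positiveCirculation⇒cycles : (X : Fin n → ℤ) → (∀ t → 0ℤ < X t) →
    (∀ g → X · (λ t → g (tgt t) - g (src t)) ≡ 0ℤ) → ∀ t → Star Edge (tgt t) (src t)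
  positiveCirculation⇒cycles X X>0 balanced t₀ with star? edge? (tgt t₀) (src t₀)
  ... | yes path = path
  ... | no ¬path = contradiction (sym (balanced ψ)) (ℤP.<⇒≢ (begin-strict
    0ℤ                                     <⟨ X>0 t₀ ⟩
    X t₀                                   ≡⟨ flow-t₀ ⟨
    flow t₀                                ≤⟨ ≤-sum flow flow≥0 t₀ ⟩
    X · (λ t → ψ (tgt t) - ψ (src t))      ∎))
    where
    open ℤP.≤-Reasoning
    reach? : ∀ v → Dec (Star Edge (tgt t₀) v)
    reach? = star? edge? (tgt t₀)
    ψ : Vector ℤ k
    ψ v = 𝟙 (reach? v)
    flow : Fin n → ℤ
    flow t = X t * (ψ (tgt t) - ψ (src t))
    flow≥0 : ∀ t → 0ℤ ≤ flow t
    flow≥0 t = ℤP.≤-trans (ℤP.≤-reflexive (sym (ℤP.*-zeroʳ (X t))))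
      (ℤP.*-monoˡ-≤-nonNeg (X t) {{ℤ.nonNegative (ℤP.<⇒≤ (X>0 t))}}
        (ℤP.i≤j⇒0≤j-i (𝟙-mono (λ path → path ◅◅ ((t , refl , refl) ◅ ε)) (reach? (src t)) (reach? (tgt t)))))
    flow-t₀ : flow t₀ ≡ X t₀
    flow-t₀ = trans (cong₂ (λ a b → X t₀ * (a - b)) (𝟙-yes ε (reach? (tgt t₀))) (𝟙-no ¬path (reach? (src t₀)))) (ℤP.*-identityʳ (X t₀))

-- Petri nets

infixl 6 _⊕_

_⊕_ : Vec ℕ p → Vec ℕ p → Vec ℕ p
_⊕_ = zipWith ℕ._+_

W : PetriNet p n → Fin n → Vector ℤ p
W N t = lookup (Wcol N t)

module _ (N : PetriNet p n) where

  fire-lookup : ∀ {m t} → Enabled N t m → ∀ q → + lookup (fire N m t) q ≡ + lookup m q + W N t q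
  fire-lookup {m} {t} enabled q = begin
    + lookup (fire N m t) q                      ≡⟨ cong +_ (lookup-zipWith ℕ._+_ q (zipWith ℕ._∸_ m (pre N t)) (post N t)) ⟩
    + (lookup (zipWith ℕ._∸_ m (pre N t)) q ℕ.+ b) ≡⟨ cong (λ x → + (x ℕ.+ b)) (lookup-zipWith ℕ._∸_ q m (pre N t)) ⟩
    + (x ℕ.∸ a ℕ.+ b)                            ≡⟨ ℤP.pos-+ (x ℕ.∸ a) b ⟩
    + (x ℕ.∸ a) + + b                            ≡⟨ cong (_+ + b) (trans (sym (ℤP.⊖-≥ (Pointwise.lookup enabled q))) (sym (ℤP.m-n≡m⊖n x a))) ⟩
    + x - + a + + b                              ≡⟨ regroup (+ x) (+ a) (+ b) ⟩
    + x + (+ b - + a)                            ≡⟨ cong (_+_ (+ x)) (lookup-zipWith _ q (post N t) (pre N t)) ⟨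
    + x + W N t q                                ∎
    where
    open ≡-Reasoning
    x a b : ℕ
    x = lookup m q
    a = lookup (pre N t) q
    b = lookup (post N t) q
    regroup : ∀ x a b → x - a + b ≡ x + (b - a)
    regroup = solve-∀

  parikh : ∀ {m m'} → Reach N m m' → Fin n → ℤ
  parikh ε                s = 0ℤ
  parikh ((t , _) ◅ path) s = e t s + parikh path s

  parikh-nonneg : ∀ {m m'} (path : Reach N m m') s → 0ℤ ≤ parikh path s
  parikh-nonneg ε                s = ℤP.≤-refl
  parikh-nonneg ((t , _) ◅ path) s = ℤP.+-mono-≤ (𝟙-nonneg (t Fin.≟ s)) (parikh-nonneg path s)

  parikh-suffix≤ : ∀ {m m' m''} (path : Reach N m m') (path' : Reach N m' m'') s →
              parikh path' s ≤ parikh (path ◅◅ path') s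
  parikh-suffix≤ ε                path' s = ℤP.≤-refl
  parikh-suffix≤ ((t , _) ◅ path) path' s =
    ℤP.≤-trans (parikh-suffix≤ path path' s) (ℤP.i≤j+i _ (e t s) {{ℤ.nonNegative (𝟙-nonneg (t Fin.≟ s))}})

  markingEquation : ∀ {m m'} (path : Reach N m m') q →
                    + lookup m' q ≡ + lookup m q + combination (parikh path) (W N) q
  markingEquation {m} ε q = sym (trans (cong (_+_ (+ lookup m q)) (sum-zero (λ s → ℤP.*-zeroˡ (W N s q))))
                                       (ℤP.+-identityʳ _))
  markingEquation {m} {m'} ((t , enabled , refl) ◅ path) q = begin
    + lookup m' q                                                  ≡⟨ markingEquation path q ⟩
    + lookup (fire N m t) q + combination (parikh path) (W N) q   ≡⟨ cong (_+ combination (parikh path) (W N) q) (fire-lookup enabled q) ⟩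
    + lookup m q + W N t q + combination (parikh path) (W N) q    ≡⟨ ℤP.+-assoc (+ lookup m q) (W N t q) (combination (parikh path) (W N) q) ⟩
    + lookup m q + (W N t q + combination (parikh path) (W N) q)  ≡⟨ cong (_+_ (+ lookup m q)) (combination-e+ t (parikh path) (W N) q) ⟨
    + lookup m q + combination (parikh ((t , enabled , refl) ◅ path)) (W N) q ∎
    where open ≡-Reasoning

  PositiveTInvariant : (Fin n → ℤ) → Set
  PositiveTInvariant X = (∀ t → 0ℤ < X t) × (∀ q → combination X (W N) q ≡ 0ℤ)

  cycle-invariant : ∀ {m} (cycle : Reach N m m) q → combination (parikh cycle) (W N) q ≡ 0ℤ
  cycle-invariant {m} cycle q = identityʳ-unique (+ lookup m q) _ (sym (markingEquation cycle q))

  module _ {m₀} (live : Live N m₀) (home : HomeMarking N m₀ m₀) where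

    cycleFiring : ∀ t → Σ (Reach N m₀ m₀) λ cycle → 0ℤ < parikh cycle t
    cycleFiring t with live m₀ ε t
    ... | m , m₀→m , enabled = m₀→m ◅◅ m→m₀ , ℤP.<-≤-trans t-fired (parikh-suffix≤ m₀→m m→m₀ t)
      where
      back : Reach N (fire N m t) m₀
      back = home _ (m₀→m ◅◅ ((t , enabled , refl) ◅ ε))
      m→m₀ : Reach N m m₀
      m→m₀ = (t , enabled , refl) ◅ back
      t-fired : 0ℤ < parikh m→m₀ t
      t-fired = begin-strict
        0ℤ                      <⟨ ℤ.+<+ (s≤s z≤n) ⟩
        1ℤ                      ≤⟨ ℤP.i≤i+j 1ℤ (parikh back t) {{ℤ.nonNegative (parikh-nonneg back t)}} ⟩
        1ℤ + parikh back t      ≡⟨ cong (_+ parikh back t) (𝟙-yes refl (t Fin.≟ t)) ⟨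
        parikh m→m₀ t           ∎
        where open ℤP.≤-Reasoning

    live-home⇒positiveTInvariant : ∃ PositiveTInvariant
    live-home⇒positiveTInvariant = X , X>0 , WX≡0
      where
      cycle : Fin n → Reach N m₀ m₀
      cycle t = proj₁ (cycleFiring t)
      X : Fin n → ℤ
      X s = sum (λ t → parikh (cycle t) s)
      X>0 : ∀ s → 0ℤ < X s
      X>0 s = ℤP.<-≤-trans (proj₂ (cycleFiring s)) (≤-sum (λ t → parikh (cycle t) s) (λ t → parikh-nonneg (cycle t) s) s)
      WX≡0 : ∀ q → combination X (W N) q ≡ 0ℤ
      WX≡0 q = trans (sum-· (λ t → parikh (cycle t)) (λ s → W N s q)) (sum-zero (λ t → cycle-invariant (cycle t) q))

  ReversibleArcs : Set
  ReversibleArcs = ∀ t → Star (Arc N) (post N t) (pre N t)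

  weaklyReversible⇒reversibleArcs : WeaklyReversible N → ReversibleArcs
  weaklyReversible⇒reversibleArcs wr t =
    wr (post N t) (pre N t) (t , inj₂ refl) (t , inj₁ refl) (bwd (t , refl , refl) ◅ ε)

  reversibleArcs⇒weaklyReversible : ReversibleArcs → WeaklyReversible N
  reversibleArcs⇒weaklyReversible reversible _ _ _ _ = undirected ⋆
    where
    undirected : ∀ {c d} → SymClosure (Arc N) c d → Star (Arc N) c d
    undirected (fwd arc)               = arc ◅ ε
    undirected (bwd (t , refl , refl)) = reversible t

  fire-translate : ∀ x t → Step N (x ⊕ pre N t) (x ⊕ post N t)
  fire-translate x t = t , enabled , cong (_⊕ post N t) (sym x+a∸a≡x)
    where
    enabled : Enabled N t (x ⊕ pre N t)
    enabled = PointwiseExt.extensional⇒inductive (ext λ q →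
      subst (lookup (pre N t) q ℕ.≤_) (sym (lookup-zipWith ℕ._+_ q x (pre N t))) (ℕP.m≤n+m _ _))
    x+a∸a≡x : zipWith ℕ._∸_ (x ⊕ pre N t) (pre N t) ≡ x
    x+a∸a≡x = lookup-ext λ q → begin
      lookup (zipWith ℕ._∸_ (x ⊕ pre N t) (pre N t)) q      ≡⟨ lookup-zipWith ℕ._∸_ q (x ⊕ pre N t) (pre N t) ⟩
      lookup (x ⊕ pre N t) q ℕ.∸ lookup (pre N t) q         ≡⟨ cong (ℕ._∸ lookup (pre N t) q) (lookup-zipWith ℕ._+_ q x (pre N t)) ⟩
      lookup x q ℕ.+ lookup (pre N t) q ℕ.∸ lookup (pre N t) q ≡⟨ ℕP.m+n∸n≡m (lookup x q) (lookup (pre N t) q) ⟩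
      lookup x q                                            ∎
      where open ≡-Reasoning

  arcs⇒firings : ∀ x {c d} → Star (Arc N) c d → Reach N (x ⊕ c) (x ⊕ d)
  arcs⇒firings x = gmap (x ⊕_) λ { (t , refl , refl) → fire-translate x t }

  -- m = (m ∸ •t) + •t, and the reverse path t• →* •t of the reaction graph fires from (m ∸ •t) + t•.
  reversibleArcs⇒reversibleSteps : ReversibleArcs → ∀ {m m'} → Step N m m' → Reach N m' m
  reversibleArcs⇒reversibleSteps reversible {m} (t , enabled , refl) =
    subst (Reach N (fire N m t)) (sym m≡rest+pre) (arcs⇒firings rest (reversible t))
    where
    rest : Marking p
    rest = zipWith ℕ._∸_ m (pre N t)
    m≡rest+pre : m ≡ rest ⊕ pre N t
    m≡rest+pre = lookup-ext λ q → sym (begin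
      lookup (rest ⊕ pre N t) q                       ≡⟨ lookup-zipWith ℕ._+_ q rest (pre N t) ⟩
      lookup rest q ℕ.+ lookup (pre N t) q            ≡⟨ cong (ℕ._+ lookup (pre N t) q) (lookup-zipWith ℕ._∸_ q m (pre N t)) ⟩
      lookup m q ℕ.∸ lookup (pre N t) q ℕ.+ lookup (pre N t) q ≡⟨ ℕP.m∸n+n≡m (Pointwise.lookup enabled q) ⟩
      lookup m q                                      ∎)
      where open ≡-Reasoning

  reversibleArcs⇒reach-sym : ReversibleArcs → ∀ {m m'} → Reach N m m' → Reach N m' m
  reversibleArcs⇒reach-sym reversible path = concat (reverse (reversibleArcs⇒reversibleSteps reversible) path)

  weaklyReversible⇒live-home : WeaklyReversible N → ∃[ m₀ ] (Live N m₀ × HomeMarking N m₀ m₀)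
  weaklyReversible⇒live-home wr = m₀ , (λ _ path t → m₀ , reach-sym path , enabled t) , (λ _ → reach-sym)
    where
    reach-sym : ∀ {m m'} → Reach N m m' → Reach N m' m
    reach-sym = reversibleArcs⇒reach-sym (weaklyReversible⇒reversibleArcs wr)
    m₀ : Marking p
    m₀ = tabulate λ q → ℕΣ.sum (λ t → lookup (pre N t) q)
    enabled : ∀ t → Enabled N t m₀
    enabled t = PointwiseExt.extensional⇒inductive (ext λ q →
      subst (lookup (pre N t) q ℕ.≤_) (sym (lookup∘tabulate _ q)) (≤-sumℕ (λ t → lookup (pre N t) q) t))

-- The reaction graph

module ReactionGraph {p n K : ℕ} (N : PetriNet p n) (complex : Fin K → Vec ℕ p)
                     (complex-onto : ∀ c → IsComplex N c → ∃ λ v → complex v ≡ c) where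

  src tgt : Fin n → Fin K
  src t = proj₁ (complex-onto (pre N t) (t , inj₁ refl))
  tgt t = proj₁ (complex-onto (post N t) (t , inj₂ refl))

  complex-src : ∀ t → complex (src t) ≡ pre N t
  complex-src t = proj₂ (complex-onto (pre N t) (t , inj₁ refl))

  complex-tgt : ∀ t → complex (tgt t) ≡ post N t
  complex-tgt t = proj₂ (complex-onto (post N t) (t , inj₂ refl))

  edge⇒arc : ∀ {u v} → Edge src tgt u v → Arc N (complex u) (complex v)
  edge⇒arc (t , refl , refl) = t , complex-src t , complex-tgt t

  incidence : Fin n → Vector ℤ K
  incidence t v = e (tgt t) v - e (src t) v

  ·-incidence : (u : Vector ℤ K) (t : Fin n) → u · incidence t ≡ u (tgt t) - u (src t)
  ·-incidence u t = begin
    sum (λ v → u v * (e (tgt t) v - e (src t) v))       ≡⟨ sum-cong-≗ (λ v → distrib (u v) (e (tgt t) v) (e (src t) v)) ⟩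
    sum (λ v → u v * e (tgt t) v - u v * e (src t) v)   ≡⟨ sum-distrib-- (λ v → u v * e (tgt t) v) (λ v → u v * e (src t) v) ⟩
    u · e (tgt t) - u · e (src t)                       ≡⟨ cong₂ _-_ (·-e u (tgt t)) (·-e u (src t)) ⟩
    u (tgt t) - u (src t)                               ∎
    where
    open ≡-Reasoning
    distrib : ∀ x a b → x * (a - b) ≡ x * a - x * b
    distrib = solve-∀

  coordinate : Fin p → Vector ℤ K
  coordinate q v = + lookup (complex v) q

  coordinate·incidence : ∀ q t → coordinate q · incidence t ≡ W N t q
  coordinate·incidence q t = begin
    coordinate q · incidence t                          ≡⟨ ·-incidence (coordinate q) t ⟩
    + lookup (complex (tgt t)) q - + lookup (complex (src t)) q
                                                        ≡⟨ cong₂ (λ c d → + lookup c q - + lookup d q) (complex-tgt t) (complex-src t) ⟩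
    + lookup (post N t) q - + lookup (pre N t) q        ≡⟨ lookup-zipWith _ q (post N t) (pre N t) ⟨
    W N t q                                             ∎
    where open ≡-Reasoning

  flow : (Fin n → ℤ) → Vector ℤ K
  flow X = combination X incidence

  balanced⇒weaklyReversible : (X : Fin n → ℤ) → (∀ t → 0ℤ < X t) → (∀ v → flow X v ≡ 0ℤ) →
                              WeaklyReversible N
  balanced⇒weaklyReversible X X>0 flow≡0 = reversibleArcs⇒weaklyReversible N reversible
    where
    balanced : ∀ g → X · (λ t → g (tgt t) - g (src t)) ≡ 0ℤ
    balanced g = begin
      X · (λ t → g (tgt t) - g (src t))     ≡⟨ sum-cong-≗ (λ t → cong (X t *_) (·-incidence g t)) ⟨
      X · (λ t → g · incidence t)           ≡⟨ ·-combination g X incidence ⟨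
      g · flow X                            ≡⟨ sum-zero (λ v → trans (cong (g v *_) (flow≡0 v)) (ℤP.*-zeroʳ (g v))) ⟩
      0ℤ                                    ∎
      where open ≡-Reasoning
    reversible : ReversibleArcs N
    reversible t = subst₂ (Star (Arc N)) (complex-tgt t) (complex-src t)
      (gmap complex edge⇒arc (positiveCirculation⇒cycles src tgt X X>0 balanced t))

  Linked : Fin K → Fin K → Set
  Linked = SymClosure (Edge src tgt)

  linked? : ∀ u v → Dec (Linked u v)
  linked? u v = map′ [ fwd , bwd ] (λ { (fwd uv) → inj₁ uv ; (bwd vu) → inj₂ vu }) (edge? src tgt u v ⊎-dec edge? src tgt v u)

  module DeficiencyBound {l r : ℕ}
    (root : Fin l → Vec ℕ p) (root-complex : ∀ j → IsComplex N (root j))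
    (roots-separated : ∀ i j → Connected N (root i) (root j) → i ≡ j)
    (σ : Fin r → Fin n) (σ-independent : LinIndep r (λ i → Wcol N (σ i)))
    (X : Fin n → ℤ) (WX≡0 : ∀ q → combination X (W N) q ≡ 0ℤ) where

    ρ : Fin l → Fin K
    ρ j = proj₁ (complex-onto (root j) (root-complex j))

    component : Fin l → Vector ℤ K
    component j v = 𝟙 (star? linked? v (ρ j))

    component·incidence : ∀ j t → component j · incidence t ≡ 0ℤ
    component·incidence j t = begin
      component j · incidence t                          ≡⟨ ·-incidence (component j) t ⟩
      component j (tgt t) - component j (src t)          ≡⟨ cong (_- component j (src t)) same-component ⟩
      component j (src t) - component j (src t)          ≡⟨ ℤP.+-inverseʳ (component j (src t)) ⟩
      0ℤ                                                 ∎
      where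
      open ≡-Reasoning
      same-component : component j (tgt t) ≡ component j (src t)
      same-component = 𝟙-cong (fwd (t , refl , refl) ◅_) (bwd (t , refl , refl) ◅_)
                              (star? linked? (tgt t) (ρ j)) (star? linked? (src t) (ρ j))

    component-root : ∀ j j' → component j (ρ j') ≡ e j j'
    component-root j j' = 𝟙-cong (sym ∘ roots-separated j' j ∘ connected) (λ { refl → ε }) (star? linked? (ρ j') (ρ j)) (j Fin.≟ j')
      where
      connected : Star Linked (ρ j') (ρ j) → Connected N (root j') (root j)
      connected path = subst₂ (Connected N) (proj₂ (complex-onto _ _)) (proj₂ (complex-onto _ _))
        (gmap complex (SymClosure.gmap complex edge⇒arc) path)

    family : Fin (suc (l ℕ.+ r)) → Vector ℤ K
    family = flow X ∷ ((e ∘ ρ) ++ (incidence ∘ σ))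

    ·-combination-family : (u : Vector ℤ K) (C : Fin (suc (l ℕ.+ r)) → ℤ) →
      u · combination C family ≡
        C zero * (u · flow X) + ((λ j → C (suc (j ↑ˡ r))) · (u ∘ ρ)
                                 + (λ i → C (suc (l ↑ʳ i))) · (λ i → u · incidence (σ i)))
    ·-combination-family u C = begin
      u · combination C family
        ≡⟨ ·-combination u C family ⟩
      C zero * (u · flow X) + sum (λ g → C (suc g) * (u · family (suc g)))
        ≡⟨ cong (_+_ (C zero * (u · flow X))) (sum-↑ l r (λ g → C (suc g) * (u · family (suc g)))) ⟩
      C zero * (u · flow X) + (sum (λ j → C (suc (j ↑ˡ r)) * (u · family (suc (j ↑ˡ r))))
                               + sum (λ i → C (suc (l ↑ʳ i)) * (u · family (suc (l ↑ʳ i)))))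
        ≡⟨ cong (λ s → C zero * (u · flow X) + s)
                (cong₂ _+_ (sum-cong-≗ λ j → cong (λ w → C (suc (j ↑ˡ r)) * (u · w)) (lookup-++ˡ (e ∘ ρ) (incidence ∘ σ) j))
                           (sum-cong-≗ λ i → cong (λ w → C (suc (l ↑ʳ i)) * (u · w)) (lookup-++ʳ (e ∘ ρ) (incidence ∘ σ) i))) ⟩
      C zero * (u · flow X) + (sum (λ j → C (suc (j ↑ˡ r)) * (u · e (ρ j)))
                               + sum (λ i → C (suc (l ↑ʳ i)) * (u · incidence (σ i))))
        ≡⟨ cong (λ s → C zero * (u · flow X) + (s + _)) (sum-cong-≗ λ j → cong (C (suc (j ↑ˡ r)) *_) (·-e u (ρ j))) ⟩
      C zero * (u · flow X) + ((λ j → C (suc (j ↑ˡ r))) · (u ∘ ρ)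
                               + (λ i → C (suc (l ↑ʳ i))) · (λ i → u · incidence (σ i)))
        ∎
      where open ≡-Reasoning

    component·flow : ∀ j → component j · flow X ≡ 0ℤ
    component·flow j = trans (·-combination (component j) X incidence)
      (sum-zero λ t → trans (cong (X t *_) (component·incidence j t)) (ℤP.*-zeroʳ (X t)))

    coordinate·flow : ∀ q → coordinate q · flow X ≡ 0ℤ
    coordinate·flow q = trans (·-combination (coordinate q) X incidence)
      (trans (sum-cong-≗ λ t → cong (X t *_) (coordinate·incidence q t)) (WX≡0 q))

    flow≢0⇒l+r<K : ∀ {v₀} → flow X v₀ ≢ 0ℤ → l ℕ.+ r ℕ.< K
    flow≢0⇒l+r<K {v₀} flow≢0 = independent⇒≤ family independent
      where
      independent : LinearlyIndependent family
      independent C C·family≡0 = coefficient≡0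
        where
        annihilated : ∀ u → u · combination C family ≡ 0ℤ
        annihilated u = sum-zero λ v → trans (cong (u v *_) (C·family≡0 v)) (ℤP.*-zeroʳ (u v))

        rootPart columnPart : Vector ℤ K → ℤ
        rootPart u = (λ j → C (suc (j ↑ˡ r))) · (u ∘ ρ)
        columnPart u = (λ i → C (suc (l ↑ʳ i))) · (λ i → u · incidence (σ i))

        parts-cancel : ∀ u → u · flow X ≡ 0ℤ → rootPart u + columnPart u ≡ 0ℤ
        parts-cancel u u·flow≡0 = begin
          rootPart u + columnPart u                                  ≡⟨ drop-zero (C zero) (rootPart u + columnPart u) ⟨
          C zero * 0ℤ + (rootPart u + columnPart u)                  ≡⟨ cong (λ x → C zero * x + (rootPart u + columnPart u)) u·flow≡0 ⟨
          C zero * (u · flow X) + (rootPart u + columnPart u)        ≡⟨ ·-combination-family u C ⟨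
          u · combination C family                                   ≡⟨ annihilated u ⟩
          0ℤ                                                         ∎
          where
          open ≡-Reasoning
          drop-zero : ∀ c x → c * 0ℤ + x ≡ x
          drop-zero = solve-∀

        root-coefficient≡0 : ∀ j → C (suc (j ↑ˡ r)) ≡ 0ℤ
        root-coefficient≡0 j = begin
          C (suc (j ↑ˡ r))                                 ≡⟨ ·-e (λ j' → C (suc (j' ↑ˡ r))) j ⟨
          (λ j' → C (suc (j' ↑ˡ r))) · e j                 ≡⟨ sum-cong-≗ (λ j' → cong (C (suc (j' ↑ˡ r)) *_) (component-root j j')) ⟨
          rootPart (component j)                           ≡⟨ ℤP.+-identityʳ _ ⟨
          rootPart (component j) + 0ℤ                      ≡⟨ cong (_+_ (rootPart (component j))) columnPart≡0 ⟨
          rootPart (component j) + columnPart (component j) ≡⟨ parts-cancel (component j) (component·flow j) ⟩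
          0ℤ                                               ∎
          where
          open ≡-Reasoning
          columnPart≡0 : columnPart (component j) ≡ 0ℤ
          columnPart≡0 = sum-zero λ i → trans (cong (C (suc (l ↑ʳ i)) *_) (component·incidence j (σ i)))
                                              (ℤP.*-zeroʳ (C (suc (l ↑ʳ i))))

        column-coefficient≡0 : ∀ i → C (suc (l ↑ʳ i)) ≡ 0ℤ
        column-coefficient≡0 = linIndep⇒independent (λ i → Wcol N (σ i)) σ-independent (λ i → C (suc (l ↑ʳ i)))
          λ q → begin
            combination (λ i → C (suc (l ↑ʳ i))) (W N ∘ σ) q            ≡⟨ sum-cong-≗ (λ i → cong (C (suc (l ↑ʳ i)) *_) (coordinate·incidence q (σ i))) ⟨
            columnPart (coordinate q)                                    ≡⟨ ℤP.+-identityˡ _ ⟨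
            0ℤ + columnPart (coordinate q)                               ≡⟨ cong (_+ columnPart (coordinate q)) rootPart≡0 ⟨
            rootPart (coordinate q) + columnPart (coordinate q)          ≡⟨ parts-cancel (coordinate q) (coordinate·flow q) ⟩
            0ℤ                                                           ∎
          where
          open ≡-Reasoning
          rootPart≡0 : ∀ {q} → rootPart (coordinate q) ≡ 0ℤ
          rootPart≡0 {q} = sum-zero λ j → trans (cong (_* coordinate q (ρ j)) (root-coefficient≡0 j))
                                                (ℤP.*-zeroˡ (coordinate q (ρ j)))

        later-coefficient≡0 : ∀ g → C (suc g) ≡ 0ℤ
        later-coefficient≡0 g = subst (λ g → C (suc g) ≡ 0ℤ) (FinP.join-splitAt l r g) (by-part (Fin.splitAt l g))
          where
          by-part : (s : Fin l ⊎ Fin r) → C (suc (Fin.join l r s)) ≡ 0ℤ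
          by-part (inj₁ j) = root-coefficient≡0 j
          by-part (inj₂ i) = column-coefficient≡0 i

        flow-coefficient≡0 : C zero ≡ 0ℤ
        flow-coefficient≡0 = ℤP.*-cancelʳ-≡ (C zero) 0ℤ (flow X v₀) {{ℤ.≢-nonZero flow≢0}} (begin
          C zero * flow X v₀                                           ≡⟨ ℤP.+-identityʳ _ ⟨
          C zero * flow X v₀ + 0ℤ                                      ≡⟨ cong (_+_ (C zero * flow X v₀))
                                                                            (sum-zero λ g → trans (cong (_* family (suc g) v₀) (later-coefficient≡0 g))
                                                                                                  (ℤP.*-zeroˡ (family (suc g) v₀))) ⟨
          combination C family v₀                                      ≡⟨ C·family≡0 v₀ ⟩
          0ℤ                                                           ≡⟨ ℤP.*-zeroˡ (flow X v₀) ⟨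
          0ℤ * flow X v₀                                               ∎)
          where open ≡-Reasoning

        coefficient≡0 : ∀ g → C g ≡ 0ℤ
        coefficient≡0 zero    = flow-coefficient≡0
        coefficient≡0 (suc g) = later-coefficient≡0 g

proposition4 : {p n : ℕ} (N : PetriNet p n) → Deficiency N 0 →
    (WeaklyReversible N ⇔ (∃[ m₀ ] (Live N m₀ × HomeMarking N m₀ m₀)))
proposition4 N (_ , l , r , (complex , _ , _ , complex-onto) , (root , root-complex , roots-separated , _) ,
                ((σ , σ-independent) , _) , refl) =
  mk⇔ (weaklyReversible⇒live-home N) λ (_ , live , home) →
    let X , X>0 , WX≡0 = live-home⇒positiveTInvariant N live home
        open DeficiencyBound root root-complex roots-separated σ σ-independent X WX≡0
    in balanced⇒weaklyReversible X X>0 λ v →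
         decidable-stable (flow X v ℤ.≟ 0ℤ) (λ flow≢0 → ℕP.<-irrefl refl (flow≢0⇒l+r<K flow≢0))
  where open ReactionGraph N complex complex-onto
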